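{- Let $n>1$ be an integer and let $G$ be a finite group with subgroups $A,B,M$ such that (1) $|A|=|B|=|M|=nk$ and $|G|=n^3k$, where $k=|A\cap B|$; (2) $AM$ and $BM$ are subgroups of $G$ of order $n^2k$; (3) $G=AMB$. If $a\in A$, $b\in B$ and $[a,b]\in AM\setminus A$, then $ab\neq b'a'$ for all $b'\in B$, $a'\in A$.
   Context: $[a,b]=a^{ -1}b^{ -1}ab$. $AM=\{am\mid a\in A, m\in M\}$, similarly $BM$ and $AMB$. -}

module Defs where

open import Level using (Level; _⊔_)
open import Algebra.Bundles using (Group)
open import Data.Nat using (ℕ)
open import Data.Fin using (Fin)
open import Data.Product using (Σ; ∃; _×_; _,_)
open import Relation.Binary.PropositionalEquality using (_≡_)

module _ {c ℓ : Level} (G : Group c ℓ) where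
  open Group G

  Subset : (p : Level) → Set (c ⊔ Level.suc p)
  Subset p = Carrier → Set p

  record IsSubgroup {p : Level} (S : Subset p) : Set (c ⊔ ℓ ⊔ p) where
    field
      resp  : ∀ {x y} → x ≈ y → S x → S y
      ε∈    : S ε
      ∙-closed : ∀ {x y} → S x → S y → S (x ∙ y)
      ⁻¹-closed : ∀ {x} → S x → S (x ⁻¹)

  record HasSize {p : Level} (S : Subset p) (m : ℕ) : Set (c ⊔ ℓ ⊔ p) where
    field
      enum      : Fin m → Carrier
      enum-in   : ∀ i → S (enum i)
      enum-inj  : ∀ i j → enum i ≈ enum j → i ≡ j
      enum-surj : ∀ x → S x → Σ (Fin m) (λ i → enum i ≈ x)

  Whole : Subset Level.zero
  Whole _ = Level.Lift Level.zero Data.Unit.⊤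
    where import Data.Unit

  _∩_ : {p q : Level} → Subset p → Subset q → Subset (p ⊔ q)
  (S ∩ T) x = S x × T x

  _·_ : {p q : Level} → Subset p → Subset q → Subset (c ⊔ ℓ ⊔ p ⊔ q)
  (S · T) x = Σ Carrier λ s → Σ Carrier λ t → S s × T t × (x ≈ s ∙ t)

  ⟦_,_⟧ : Carrier → Carrier → Carrier
  ⟦ a , b ⟧ = ((a ⁻¹ ∙ b ⁻¹) ∙ a) ∙ b

-- If ab = b'a', then [a,b] = a⁻¹ (b⁻¹b') a', so x = b⁻¹b' is an element of
-- AM ∩ B outside A.  Hence AM ∩ B has at least |A ∩ B| + 1 = k + 1 elements.
-- Every element of G = (AM)B has at least |AM ∩ B| factorisations g = yb
-- with y ∈ AM, b ∈ B (namely (yu)(u⁻¹b) for u ∈ AM ∩ B), so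
-- |G| (k + 1) ≤ |AM| |B|, i.e. n³k(k + 1) ≤ n²k · nk = n³k · k: impossible.
-- Only the orders of A ∩ B, B, AM and G enter.
module Submission where

open import Defs
open import Level using (Level; lift)
open import Data.Unit using (tt)
open import Algebra.Bundles using (Group)
open import Data.Nat using (ℕ; suc; _*_; _^_; _<_; _≤_; _≰_)
open import Data.Nat.Properties using (n<1+n; *-monoʳ-<; <⇒≱; module ≤-Reasoning)
open import Data.Nat.Solver using (module +-*-Solver)
open import Data.Fin using (Fin; zero; suc)
open import Data.Fin.Properties using (*↔×; injective⇒≤)
open import Data.Product using (_×_; _,_; proj₁; proj₂)
open import Function using (_∘_; Injective; Injection)
open import Function.Properties.Inverse using (↔⇒↣)
open import Function.Construct.Symmetry using (↔-sym)
open import Relation.Nullary using (¬_; contradiction)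
open import Relation.Binary.PropositionalEquality using (_≡_; refl; cong)

injective⇒*≤* : ∀ {a b c d} {f : Fin a × Fin b → Fin c × Fin d} →
                Injective _≡_ _≡_ f → a * b ≤ c * d
injective⇒*≤* f-injective = injective⇒≤
  (Injection.injective (↔⇒↣ *↔×) ∘ f-injective ∘ Injection.injective (↔⇒↣ (↔-sym *↔×)))

*-suc-≰ : ∀ {m} → Fin m → ∀ k → m * suc k ≰ m * k
*-suc-≰ {suc m} _ k = <⇒≱ (*-monoʳ-< (suc m) (n<1+n k))

module _ {c ℓ : Level} (G : Group c ℓ) where
  open Group G hiding (refl)
  open import Algebra.Properties.Group G
    using (∙-cancelˡ; \\-leftDividesˡ; \\-leftDividesʳ; //-rightDividesʳ)
  open import Relation.Binary.Reasoning.Setoid setoid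

  module _ {p : Level} {S : Subset G p} {m : ℕ} (S-size : HasSize G S m) where
    open HasSize S-size

    index : ∀ {x} → S x → Fin m
    index {x} x∈S = proj₁ (enum-surj x x∈S)

    index-injective : ∀ {x y} (x∈S : S x) (y∈S : S y) → index x∈S ≡ index y∈S → x ≈ y
    index-injective {x} {y} x∈S y∈S eq = begin
      x                ≈⟨ sym (proj₂ (enum-surj x x∈S)) ⟩
      enum (index x∈S) ≡⟨ cong enum eq ⟩
      enum (index y∈S) ≈⟨ proj₂ (enum-surj y y∈S) ⟩
      y                ∎

    insert : Carrier → Fin (suc m) → Carrier
    insert x zero    = x
    insert x (suc t) = enum t

    insert-injective : ∀ {x} → (∀ {y} → S y → ¬ y ≈ x) → Injective _≡_ _≈_ (insert x)
    insert-injective x∉S {zero}  {zero}  _  = refl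
    insert-injective x∉S {zero}  {suc t} eq = contradiction (sym eq) (x∉S (enum-in t))
    insert-injective x∉S {suc s} {zero}  eq = contradiction eq (x∉S (enum-in s))
    insert-injective x∉S {suc s} {suc t} eq = cong suc (enum-inj s t eq)

  ⊆·subgroup : ∀ {p q} {S : Subset G p} {H : Subset G q} → IsSubgroup G H →
               ∀ {x} → S x → _·_ G S H x
  ⊆·subgroup H≤G {x} x∈S = x , ε , x∈S , IsSubgroup.ε∈ H≤G , sym (identityʳ x)

  double-coset-∈ : ∀ {p} {H : Subset G p} → IsSubgroup G H →
                   ∀ {h h' y} → H h → H h' → H (h ∙ (y ∙ h')) → H y
  double-coset-∈ H≤G {h} {h'} {y} h∈H h'∈H hyh'∈H =
    resp h⁻¹hyh'h'⁻¹≈y (∙-closed (∙-closed (⁻¹-closed h∈H) hyh'∈H) (⁻¹-closed h'∈H))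
    where
      open IsSubgroup H≤G
      h⁻¹hyh'h'⁻¹≈y : (h \\ (h ∙ (y ∙ h'))) // h' ≈ y
      h⁻¹hyh'h'⁻¹≈y = trans (∙-congʳ (\\-leftDividesʳ h (y ∙ h'))) (//-rightDividesʳ h' y)

  regroup : ∀ y u z → y ∙ z ≈ (y ∙ u) ∙ (u \\ z)
  regroup y u z = begin
    y ∙ z                ≈⟨ ∙-congˡ (\\-leftDividesˡ u z) ⟨
    y ∙ (u ∙ (u \\ z))   ≈⟨ assoc y u (u \\ z) ⟨
    (y ∙ u) ∙ (u \\ z)   ∎

  module _ {p q} {H : Subset G p} {K : Subset G q}
           (H≤G : IsSubgroup G H) (K≤G : IsSubgroup G K) (G≡HK : ∀ x → _·_ G H K x)
           {N P Q : ℕ} (G-size : HasSize G (Whole G) N)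
           (H-size : HasSize G H P) (K-size : HasSize G K Q) where
    open HasSize G-size using (enum; enum-inj)
    private
      module H = IsSubgroup H≤G
      module K = IsSubgroup K≤G

      h k : Fin N → Carrier
      h i = proj₁ (G≡HK (enum i))
      k i = proj₁ (proj₂ (G≡HK (enum i)))

      h∈H : ∀ i → H (h i)
      h∈H i = proj₁ (proj₂ (proj₂ (G≡HK (enum i))))

      k∈K : ∀ i → K (k i)
      k∈K i = proj₁ (proj₂ (proj₂ (proj₂ (G≡HK (enum i)))))

      enum≈hk : ∀ i → enum i ≈ h i ∙ k i
      enum≈hk i = proj₂ (proj₂ (proj₂ (proj₂ (G≡HK (enum i)))))

    -- (h, k) ↦ (hu, u⁻¹k) for u ∈ H ∩ K moves inside the fibre of h k.
    ∣G∣*∣H∩K∣≤∣H∣*∣K∣ : ∀ {m} (u : Fin m → Carrier) → (∀ t → _∩_ G H K (u t)) →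
                        Injective _≡_ _≈_ u → N * m ≤ P * Q
    ∣G∣*∣H∩K∣≤∣H∣*∣K∣ {m} u u∈H∩K u-injective = injective⇒*≤* shift-injective
      where
        hu∈H : ∀ i t → H (h i ∙ u t)
        hu∈H i t = H.∙-closed (h∈H i) (proj₁ (u∈H∩K t))

        u\\k∈K : ∀ i t → K (u t \\ k i)
        u\\k∈K i t = K.∙-closed (K.⁻¹-closed (proj₂ (u∈H∩K t))) (k∈K i)

        shift : Fin N × Fin m → Fin P × Fin Q
        shift (i , t) = index H-size (hu∈H i t) , index K-size (u\\k∈K i t)

        same-shift : ∀ i j s t → h i ∙ u s ≈ h j ∙ u t → u s \\ k i ≈ u t \\ k j →
                     (i , s) ≡ (j , t)
        same-shift i j s t hu≈ u\\k≈ with refl ← enum-inj i j (begin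
          enum i                       ≈⟨ enum≈hk i ⟩
          h i ∙ k i                    ≈⟨ regroup (h i) (u s) (k i) ⟩
          (h i ∙ u s) ∙ (u s \\ k i)   ≈⟨ ∙-cong hu≈ u\\k≈ ⟩
          (h j ∙ u t) ∙ (u t \\ k j)   ≈⟨ regroup (h j) (u t) (k j) ⟨
          h j ∙ k j                    ≈⟨ enum≈hk j ⟨
          enum j                       ∎)
          = cong (i ,_) (u-injective (∙-cancelˡ (h i) (u s) (u t) hu≈))

        shift-injective : Injective _≡_ _≡_ shift
        shift-injective {i , s} {j , t} eq = same-shift i j s t
          (index-injective H-size (hu∈H i s) (hu∈H j t) (cong proj₁ eq))
          (index-injective K-size (u\\k∈K i s) (u\\k∈K j t) (cong proj₂ eq))

  ∙≈∙⇒commutator≈ : ∀ {a b a' b'} → a ∙ b ≈ b' ∙ a' → ⟦_,_⟧ G a b ≈ a ⁻¹ ∙ ((b \\ b') ∙ a')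
  ∙≈∙⇒commutator≈ {a} {b} {a'} {b'} ab≈b'a' = begin
    ((a ⁻¹ ∙ b ⁻¹) ∙ a) ∙ b      ≈⟨ assoc _ a b ⟩
    (a ⁻¹ ∙ b ⁻¹) ∙ (a ∙ b)      ≈⟨ ∙-congˡ ab≈b'a' ⟩
    (a ⁻¹ ∙ b ⁻¹) ∙ (b' ∙ a')    ≈⟨ assoc _ _ _ ⟩
    a ⁻¹ ∙ (b ⁻¹ ∙ (b' ∙ a'))    ≈⟨ ∙-congˡ (assoc _ _ _) ⟨
    a ⁻¹ ∙ ((b \\ b') ∙ a')      ∎

lemma2p11 : {c ℓ p : Level} (G : Group c ℓ) (n k : ℕ) (A B M : Subset G p) →
    1 < n →
    IsSubgroup G A → IsSubgroup G B → IsSubgroup G M →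
    HasSize G (_∩_ G A B) k →
    HasSize G A (n * k) → HasSize G B (n * k) → HasSize G M (n * k) →
    HasSize G (Whole G) (n ^ 3 * k) →
    IsSubgroup G (_·_ G A M) → IsSubgroup G (_·_ G B M) →
    HasSize G (_·_ G A M) (n ^ 2 * k) → HasSize G (_·_ G B M) (n ^ 2 * k) →
    (∀ x → _·_ G (_·_ G A M) B x) →
    ∀ a b → A a → B b →
    _·_ G A M (⟦_,_⟧ G a b) → ¬ A (⟦_,_⟧ G a b) →
    ∀ b' a' → B b' → A a' → ¬ (Group._≈_ G (Group._∙_ G a b) (Group._∙_ G b' a'))
lemma2p11 G n k A B M _ A≤G B≤G M≤G A∩B-size _ B-size _ G-size AM≤G _ AM-size _ G≡AMB
          a b a∈A b∈B ⟦a,b⟧∈AM ⟦a,b⟧∉A b' a' b'∈B a'∈A ab≈b'a' =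
  *-suc-≰ (index G G-size {ε} (lift tt)) k (begin
    n ^ 3 * k * suc k   ≤⟨ ∣G∣*∣H∩K∣≤∣H∣*∣K∣ G AM≤G B≤G G≡AMB G-size AM-size B-size
                             (insert G A∩B-size x) insert-x∈AM∩B (insert-injective G A∩B-size x∉A∩B) ⟩
    n ^ 2 * k * (n * k) ≡⟨ solve 2 (λ n k → n :^ 2 :* k :* (n :* k) := n :^ 3 :* k :* k) refl n k ⟩
    n ^ 3 * k * k       ∎)
  where
    open Group G using (_≈_; _∙_; _⁻¹; _\\_; ε; sym)
    open ≤-Reasoning
    open +-*-Solver
    module A = IsSubgroup A≤G
    module B = IsSubgroup B≤G

    x = b \\ b'

    ⟦a,b⟧≈a⁻¹xa' : ⟦_,_⟧ G a b ≈ a ⁻¹ ∙ (x ∙ a')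
    ⟦a,b⟧≈a⁻¹xa' = ∙≈∙⇒commutator≈ G ab≈b'a'

    A⊆AM : ∀ {y} → A y → _·_ G A M y
    A⊆AM = ⊆·subgroup G M≤G

    x∈AM : _·_ G A M x
    x∈AM = double-coset-∈ G AM≤G (A⊆AM (A.⁻¹-closed a∈A)) (A⊆AM a'∈A)
             (IsSubgroup.resp AM≤G ⟦a,b⟧≈a⁻¹xa' ⟦a,b⟧∈AM)

    x∉A∩B : ∀ {y} → _∩_ G A B y → ¬ y ≈ x
    x∉A∩B (y∈A , _) y≈x = ⟦a,b⟧∉A (A.resp (sym ⟦a,b⟧≈a⁻¹xa')
      (A.∙-closed (A.⁻¹-closed a∈A) (A.∙-closed (A.resp y≈x y∈A) a'∈A)))

    insert-x∈AM∩B : ∀ t → _∩_ G (_·_ G A M) B (insert G A∩B-size x t)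
    insert-x∈AM∩B zero    = x∈AM , B.∙-closed (B.⁻¹-closed b∈B) b'∈B
    insert-x∈AM∩B (suc t) = A⊆AM (proj₁ y∈A∩B) , proj₂ y∈A∩B
      where
        y∈A∩B : _∩_ G A B (HasSize.enum A∩B-size t)
        y∈A∩B = HasSize.enum-in A∩B-size t
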